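{- Let $(a_n)_{n\ge1}$, $(b_n)_{n\ge1}$, $(c_n)_{n\ge2}$ be real sequences and let $T=[t_{n,k}]_{n,k\ge0}$ be defined by $t_{0,0}=1$ and $t_{n,k}=a_nt_{n-1,k-1}+b_nt_{n-1,k}+c_nt_{n-2,k-1}$, where $t_{n,k}=0$ unless $n\ge k\ge0$. Define $$Q:=L(\boldsymbol\beta)\begin{bmatrix}1&\\&D(\boldsymbol\alpha,\boldsymbol\gamma)\end{bmatrix},\qquad L(\boldsymbol\beta)=\Big[\tfrac{(\boldsymbol\beta_n)!}{(\boldsymbol\beta_k)!}\cdot\mathrm{I}[n\ge k]\Big]_{n,k\ge0},\qquad D(\boldsymbol\alpha,\boldsymbol\gamma)=\begin{bmatrix}a_1&&&\\c_2&a_2&&\\&c_3&a_3&\\&&\ddots&\ddots\end{bmatrix}.$$ Then $Q$ is the left production matrix of $T$, i.e. $T=Q\begin{bmatrix}I_1&\\&Q\end{bmatrix}\begin{bmatrix}I_2&\\&Q\end{bmatrix}\cdots$.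
   Context: Here $\frac{(\boldsymbol\beta_n)!}{(\boldsymbol\beta_k)!}$ for $n\ge k$ denotes the product $b_{k+1}b_{k+2}\cdots b_n$ (equal to $1$ when $n=k$), where $(\boldsymbol\beta_n)!=b_1\cdots b_n$; $\mathrm{I}[n\ge k]$ is $1$ if $n\ge k$ and $0$ otherwise. $D(\boldsymbol\alpha,\boldsymbol\gamma)$ is lower bidiagonal with diagonal $a_1,a_2,\dots$ and subdiagonal $c_2,c_3,\dots$. $I_k$ is the $k\times k$ identity and the block matrices are block diagonal; the infinite product is well defined since leading principal submatrices of the partial products stabilize. -}

module Defs where

open import Level using (Level)
open import Data.Nat using (ℕ; zero; suc; _∸_; _≤?_; _<?_)
open import Data.Nat.Properties using (_≟_)
open import Data.Bool using (_∨_; if_then_else_)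
open import Relation.Nullary using (yes; no)
open import Relation.Nullary.Decidable using (⌊_⌋)
open import Algebra.Bundles using (CommutativeRing)

-- Infinite matrices indexed by ℕ × ℕ (rows n, columns k, both from 0),
-- with entries in a commutative ring R.  The paper works over the reals;
-- the identity is polynomial.
module Setup {c ℓ : Level} (R : CommutativeRing c ℓ)
             (a b γ : ℕ → CommutativeRing.Carrier R) where

  open CommutativeRing R using (Carrier; _+_; _*_; 0#; 1#)

  Mat : Set c
  Mat = ℕ → ℕ → Carrier

  sumBelow : ℕ → (ℕ → Carrier) → Carrier
  sumBelow zero    f = 0#
  sumBelow (suc n) f = sumBelow n f + f n

  -- Product of infinite matrices, where the left factor is lower
  -- triangular (all matrices multiplied here are): (A B)_{n,k} = Σ_{j=0}^{n} A_{n,j} B_{j,k}.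
  _⊗_ : Mat → Mat → Mat
  (A ⊗ B) n k = sumBelow (suc n) (λ j → A n j * B j k)

  -- The triangle T: t_{0,0} = 1, t_{n,k} = 0 unless n ≥ k ≥ 0, and for
  -- n ≥ 1, n ≥ k ≥ 0:
  --   t_{n,k} = a_n t_{n-1,k-1} + b_n t_{n-1,k} + c_n t_{n-2,k-1}
  -- (terms with a negative index being 0).  γ plays the role of c.
  t : Mat
  t zero zero = 1#
  t zero (suc k) = 0#
  t (suc n) zero = b (suc n) * t n zero
  t (suc zero) (suc k) =
    if ⌊ suc k ≤? 1 ⌋
    then a 1 * t zero k + b 1 * t zero (suc k)
    else 0#
  t (suc (suc n)) (suc k) =
    if ⌊ suc k ≤? suc (suc n) ⌋
    then a (suc (suc n)) * t (suc n) k
         + b (suc (suc n)) * t (suc n) (suc k)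
         + γ (suc (suc n)) * t n k
    else 0#

  -- β-ratio: (β_n)!/(β_k)! = b_{k+1} b_{k+2} ⋯ b_n  for n ≥ k (1 if n = k)
  bratio : ℕ → ℕ → Carrier
  bratio k zero = 1#
  bratio k (suc n) with k ≤? n
  ... | yes _ = bratio k n * b (suc n)
  ... | no  _ = 1#

  Lβ : Mat
  Lβ n k with k ≤? n
  ... | yes _ = bratio k n
  ... | no  _ = 0#

  -- D(α,γ): lower bidiagonal, diagonal a_1, a_2, …, subdiagonal c_2, c_3, …
  -- (0-indexed: D_{i,i} = a_{i+1}, D_{i+1,i} = c_{i+2}).
  Dαγ : Mat
  Dαγ i j with i ≟ j
  ... | yes _ = a (suc i)
  ... | no  _ with i ≟ suc j
  ...   | yes _ = γ (suc i)
  ...   | no  _ = 0#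

  blk : ℕ → Mat → Mat
  blk m A n k =
    if ⌊ n <? m ⌋ ∨ ⌊ k <? m ⌋
    then (if ⌊ n ≟ k ⌋ then 1# else 0#)
    else A (n ∸ m) (k ∸ m)

  Q : Mat
  Q = Lβ ⊗ blk 1 Dαγ

  partialProd : ℕ → Mat
  partialProd zero    = Q
  partialProd (suc m) = partialProd m ⊗ blk (suc m) Q

{-# OPTIONS --safe #-}
module Submission where

-- Write P m for the m-th partial product.  Since A ↦ [I₁, A] is multiplicative and
-- [I₁, [I_s, A]] = [I_(s+1), A], associativity (valid since the middle factors are lower
-- triangular) gives P (m+1) = Q [I₁, P m].  Row n of a product only sees rows ≤ n of its
-- right factor, so once T = Q [I₁, T] is known, induction on m shows that P m agrees with T
-- on rows ≤ m.  Finally T = L(β) [I₁, D T] because L(β)⁻¹ is bidiagonal with diagonal 1 and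
-- subdiagonal −b_(n+1): row n+1 of the identity reads
-- t_(n+1,k) − b_(n+1) t_(n,k) = a_(n+1) t_(n,k−1) + c_(n+1) t_(n−1,k−1), the defining recurrence.

open import Defs
open import Level using (Level)
open import Data.Nat using (ℕ; _≤_)
open import Data.Product using (∃)
open import Algebra.Bundles using (CommutativeRing)

open import Data.Nat using (zero; suc; _∸_; _<_; _≤′_; ≤′-refl; ≤′-step; _<?_; _≤?_; z≤n; s≤s)
open import Data.Nat.Properties
  using ( _≟_; <⇒≢; >⇒≢; 1+n≢n; <⇒≱; ≰⇒>; ≤-pred; ≤-refl; ≤-trans; <⇒≤
        ; m≤n⇒m≤1+n; m<n⇒m<1+n; n<1+n; ≤⇒≤′; ≤′⇒≤)
open import Data.Product using (_,_)
open import Data.Bool using (if_then_else_)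
open import Data.Bool.Properties using (∨-zeroʳ)
open import Relation.Nullary using (yes; no; contradiction)
open import Relation.Nullary.Decidable using (⌊_⌋; isYes≗does)
open import Relation.Binary.PropositionalEquality as ≡ using (_≡_; _≢_)
import Algebra.Properties.CommutativeSemigroup as CommutativeSemigroupProperties
import Relation.Binary.Reasoning.Setoid as SetoidReasoning

module Production {c ℓ : Level} (R : CommutativeRing c ℓ)
                  (a b γ : ℕ → CommutativeRing.Carrier R) where

  open CommutativeRing R
  open Setup R a b γ
  open SetoidReasoning setoid
  open CommutativeSemigroupProperties +-commutativeSemigroup
    using (interchange; xy∙z≈y∙zx)

  infix 4 _≋_

  _≋_ : Mat → Mat → Set ℓ
  A ≋ B = ∀ n k → A n k ≈ B n k

  LowerTriangular : Mat → Set ℓ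
  LowerTriangular A = ∀ {i j} → i < j → A i j ≈ 0#

  AgreeUpToRow : ℕ → Mat → Mat → Set ℓ
  AgreeUpToRow n A B = ∀ {j} k → j ≤ n → A j k ≈ B j k

  I : Mat
  I n k = if ⌊ n ≟ k ⌋ then 1# else 0#

  *-≈0ʳ : ∀ x {y} → y ≈ 0# → x * y ≈ 0#
  *-≈0ʳ x y≈0 = trans (*-congˡ y≈0) (zeroʳ x)

  *-≈0ˡ : ∀ {x} y → x ≈ 0# → x * y ≈ 0#
  *-≈0ˡ y x≈0 = trans (*-congʳ x≈0) (zeroˡ y)

  Σ-cong : ∀ N {f g} → (∀ {j} → j < N → f j ≈ g j) → sumBelow N f ≈ sumBelow N g
  Σ-cong zero    f≈g = refl
  Σ-cong (suc N) f≈g = +-cong (Σ-cong N (λ j<N → f≈g (m<n⇒m<1+n j<N))) (f≈g (n<1+n N))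

  Σ-zero : ∀ N {f} → (∀ {j} → j < N → f j ≈ 0#) → sumBelow N f ≈ 0#
  Σ-zero zero    f≈0 = refl
  Σ-zero (suc N) f≈0 =
    trans (+-cong (Σ-zero N (λ j<N → f≈0 (m<n⇒m<1+n j<N))) (f≈0 (n<1+n N))) (+-identityˡ 0#)

  Σ-+ : ∀ N f g → sumBelow N (λ j → f j + g j) ≈ sumBelow N f + sumBelow N g
  Σ-+ zero    f g = sym (+-identityˡ 0#)
  Σ-+ (suc N) f g = trans (+-congʳ (Σ-+ N f g)) (interchange _ _ _ _)

  Σ-*ˡ : ∀ N f x → x * sumBelow N f ≈ sumBelow N (λ j → x * f j)
  Σ-*ˡ zero    f x = zeroʳ x
  Σ-*ˡ (suc N) f x = trans (distribˡ x _ _) (+-congʳ (Σ-*ˡ N f x))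

  Σ-*ʳ : ∀ N f x → sumBelow N f * x ≈ sumBelow N (λ j → f j * x)
  Σ-*ʳ zero    f x = zeroˡ x
  Σ-*ʳ (suc N) f x = trans (distribʳ x _ _) (+-congʳ (Σ-*ʳ N f x))

  Σ-swap : ∀ N M (f : ℕ → ℕ → Carrier) →
           sumBelow N (λ i → sumBelow M (f i)) ≈ sumBelow M (λ j → sumBelow N (λ i → f i j))
  Σ-swap zero    M f = sym (Σ-zero M (λ _ → refl))
  Σ-swap (suc N) M f =
    trans (+-congʳ (Σ-swap N M f)) (sym (Σ-+ M (λ j → sumBelow N (λ i → f i j)) (f N)))

  Σ-head : ∀ N f → sumBelow (suc N) f ≈ f 0 + sumBelow N (λ j → f (suc j))
  Σ-head zero    f = +-comm 0# (f 0)
  Σ-head (suc N) f = trans (+-congʳ (Σ-head N f)) (+-assoc _ _ _)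

  Σ-extend : ∀ {N M f} → N ≤ M → (∀ {j} → N ≤ j → f j ≈ 0#) → sumBelow M f ≈ sumBelow N f
  Σ-extend {N} {f = f} N≤M f≈0 = go (≤⇒≤′ N≤M)
    where
    go : ∀ {M} → N ≤′ M → sumBelow M f ≈ sumBelow N f
    go ≤′-refl        = refl
    go (≤′-step N≤′M) = trans (+-cong (go N≤′M) (f≈0 (≤′⇒≤ N≤′M))) (+-identityʳ _)

  ⊗-congˡ : ∀ A {B B'} → B ≋ B' → A ⊗ B ≋ A ⊗ B'
  ⊗-congˡ A B≋B' n k = Σ-cong (suc n) (λ {j} _ → *-congˡ (B≋B' j k))

  ⊗-congʳ : ∀ B {A A'} → A ≋ A' → A ⊗ B ≋ A' ⊗ B
  ⊗-congʳ B A≋A' n k = Σ-cong (suc n) (λ {j} _ → *-congʳ (A≋A' n j))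

  ⊗-agreeUpToRow : ∀ A {n B B'} → AgreeUpToRow n B B' → AgreeUpToRow n (A ⊗ B) (A ⊗ B')
  ⊗-agreeUpToRow A B≈B' k j≤n =
    Σ-cong _ (λ i<1+j → *-congˡ (B≈B' k (≤-trans (≤-pred i<1+j) j≤n)))

  ⊗-lower : ∀ A {B} → LowerTriangular B → LowerTriangular (A ⊗ B)
  ⊗-lower A B-lower i<j = Σ-zero _ (λ l<1+i → *-≈0ʳ _ (B-lower (≤-trans l<1+i i<j)))

  ⊗-assoc : ∀ A B C → LowerTriangular B → (A ⊗ B) ⊗ C ≋ A ⊗ (B ⊗ C)
  ⊗-assoc A B C B-lower n k = begin
    sumBelow (suc n) (λ j → sumBelow (suc n) (λ i → A n i * B i j) * C j k)
      ≈⟨ Σ-cong (suc n) (λ {j} _ → Σ-*ʳ (suc n) (λ i → A n i * B i j) (C j k)) ⟩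
    sumBelow (suc n) (λ j → sumBelow (suc n) (λ i → A n i * B i j * C j k))
      ≈⟨ Σ-cong (suc n) (λ _ → Σ-cong (suc n) (λ _ → *-assoc _ _ _)) ⟩
    sumBelow (suc n) (λ j → sumBelow (suc n) (λ i → A n i * (B i j * C j k)))
      ≈⟨ Σ-swap (suc n) (suc n) (λ i j → A n i * (B i j * C j k)) ⟨
    sumBelow (suc n) (λ i → sumBelow (suc n) (λ j → A n i * (B i j * C j k)))
      ≈⟨ Σ-cong (suc n) (λ {i} _ → Σ-*ˡ (suc n) (λ j → B i j * C j k) (A n i)) ⟨
    sumBelow (suc n) (λ i → A n i * sumBelow (suc n) (λ j → B i j * C j k))
      ≈⟨ Σ-cong (suc n) (λ i<1+n → *-congˡ (Σ-extend i<1+n (λ i<j → *-≈0ˡ _ (B-lower i<j)))) ⟩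
    (A ⊗ (B ⊗ C)) n k ∎

  -- A stuck ⌊ d ⌋ is compared through d, proof component included; only `does d` computes under suc.
  ⌊<?⌋-suc : ∀ m n → ⌊ suc m <? suc n ⌋ ≡ ⌊ m <? n ⌋
  ⌊<?⌋-suc m n = ≡.trans (isYes≗does (suc m <? suc n)) (≡.sym (isYes≗does (m <? n)))

  ⌊≟⌋-suc : ∀ m n → ⌊ suc m ≟ suc n ⌋ ≡ ⌊ m ≟ n ⌋
  ⌊≟⌋-suc m n = ≡.trans (isYes≗does (suc m ≟ suc n)) (≡.sym (isYes≗does (m ≟ n)))

  blk-suc-suc : ∀ s A n k → blk (suc s) A (suc n) (suc k) ≡ blk s A n k
  blk-suc-suc s A n k rewrite ⌊<?⌋-suc n s | ⌊<?⌋-suc k s | ⌊≟⌋-suc n k = ≡.refl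

  blk-lower : ∀ s {A} → LowerTriangular A → LowerTriangular (blk s A)
  blk-lower zero    A-lower i<j = A-lower i<j
  blk-lower (suc s) A-lower {zero}  {suc j} _           = refl
  blk-lower (suc s) {A} A-lower {suc i} {suc j} (s≤s i<j) =
    trans (reflexive (blk-suc-suc s A i j)) (blk-lower s A-lower i<j)

  blk-suc : ∀ s A → blk (suc s) A ≋ blk 1 (blk s A)
  blk-suc s A zero    k       = refl
  blk-suc s A (suc n) zero    = reflexive (≡.cong (if_then 0# else A (n ∸ s) 0) (∨-zeroʳ _))
  blk-suc s A (suc n) (suc k) = reflexive (blk-suc-suc s A n k)

  blk₁-⊗ : ∀ A B → blk 1 (A ⊗ B) ≋ blk 1 A ⊗ blk 1 B
  blk₁-⊗ A B zero    k       = sym (trans (+-identityˡ _) (*-identityˡ _))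
  blk₁-⊗ A B (suc n) zero    = sym (Σ-zero (suc (suc n)) vanish)
    where
    vanish : ∀ {j} → j < suc (suc n) → blk 1 A (suc n) j * blk 1 B j 0 ≈ 0#
    vanish {zero}  _ = zeroˡ _
    vanish {suc j} _ = zeroʳ _
  blk₁-⊗ A B (suc n) (suc k) = sym (begin
    sumBelow (suc (suc n)) (λ j → blk 1 A (suc n) j * blk 1 B j (suc k)) ≈⟨ Σ-head (suc n) _ ⟩
    0# * I 0 (suc k) + (A ⊗ B) n k                                       ≈⟨ +-congʳ (zeroˡ _) ⟩
    0# + (A ⊗ B) n k                                                     ≈⟨ +-identityˡ _ ⟩
    (A ⊗ B) n k                                                          ∎)

  blk₁-agreeUpToRow : ∀ {n A B} → AgreeUpToRow n A B → AgreeUpToRow (suc n) (blk 1 A) (blk 1 B)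
  blk₁-agreeUpToRow A≈B {zero}  k       _         = refl
  blk₁-agreeUpToRow A≈B {suc j} zero    _         = refl
  blk₁-agreeUpToRow A≈B {suc j} (suc k) (s≤s j≤n) = A≈B k j≤n

  D-diag : ∀ i → Dαγ i i ≡ a (suc i)
  D-diag i with i ≟ i
  ... | yes _   = ≡.refl
  ... | no  i≢i = contradiction ≡.refl i≢i

  D-sub : ∀ i → Dαγ (suc i) i ≡ γ (suc (suc i))
  D-sub i with suc i ≟ i
  ... | yes 1+i≡i = contradiction 1+i≡i 1+n≢n
  ... | no  _ with suc i ≟ suc i
  ...   | yes _     = ≡.refl
  ...   | no  i≢i   = contradiction ≡.refl i≢i

  D-off : ∀ {i j} → i ≢ j → i ≢ suc j → Dαγ i j ≡ 0#
  D-off {i} {j} i≢j i≢1+j with i ≟ j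
  ... | yes i≡j = contradiction i≡j i≢j
  ... | no  _ with i ≟ suc j
  ...   | yes i≡1+j = contradiction i≡1+j i≢1+j
  ...   | no  _     = ≡.refl

  D-lower : LowerTriangular Dαγ
  D-lower i<j = reflexive (D-off (<⇒≢ i<j) (<⇒≢ (m<n⇒m<1+n i<j)))

  D-⊗-zero : ∀ X k → (Dαγ ⊗ X) 0 k ≈ a 1 * X 0 k
  D-⊗-zero X k = +-identityˡ _

  D-⊗-suc : ∀ X n k →
            (Dαγ ⊗ X) (suc n) k ≈ γ (suc (suc n)) * X n k + a (suc (suc n)) * X (suc n) k
  D-⊗-suc X n k = begin
    sumBelow n (λ j → Dαγ (suc n) j * X j k) + Dαγ (suc n) n * X n k
      + Dαγ (suc n) (suc n) * X (suc n) k
      ≈⟨ +-cong (+-cong (Σ-zero n far) (*-congʳ (reflexive (D-sub n))))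
                (*-congʳ (reflexive (D-diag (suc n)))) ⟩
    0# + γ (suc (suc n)) * X n k + a (suc (suc n)) * X (suc n) k
      ≈⟨ +-congʳ (+-identityˡ _) ⟩
    γ (suc (suc n)) * X n k + a (suc (suc n)) * X (suc n) k ∎
    where
    far : ∀ {j} → j < n → Dαγ (suc n) j * X j k ≈ 0#
    far j<n = *-≈0ˡ _ (reflexive (D-off (>⇒≢ (m<n⇒m<1+n j<n)) (>⇒≢ (s≤s j<n))))

  bratio-refl : ∀ n → bratio n n ≡ 1#
  bratio-refl zero = ≡.refl
  bratio-refl (suc n) with suc n ≤? n
  ... | yes 1+n≤n = contradiction 1+n≤n (<⇒≱ (n<1+n n))
  ... | no  _     = ≡.refl

  bratio-suc : ∀ {j n} → j ≤ n → bratio j (suc n) ≡ bratio j n * b (suc n)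
  bratio-suc {j} {n} j≤n with j ≤? n
  ... | yes _   = ≡.refl
  ... | no  j≰n = contradiction j≤n j≰n

  Lβ-entry : ∀ {n j} → j ≤ n → Lβ n j ≡ bratio j n
  Lβ-entry {n} {j} j≤n with j ≤? n
  ... | yes _   = ≡.refl
  ... | no  j≰n = contradiction j≤n j≰n

  Lβ-diag : ∀ n → Lβ n n ≈ 1#
  Lβ-diag n = reflexive (≡.trans (Lβ-entry {n} ≤-refl) (bratio-refl n))

  Lβ-suc : ∀ {n j} → j ≤ n → Lβ (suc n) j ≈ b (suc n) * Lβ n j
  Lβ-suc {n} {j} j≤n = begin
    Lβ (suc n) j           ≡⟨ Lβ-entry (m≤n⇒m≤1+n j≤n) ⟩
    bratio j (suc n)       ≡⟨ bratio-suc j≤n ⟩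
    bratio j n * b (suc n) ≡⟨ ≡.cong (_* b (suc n)) (Lβ-entry j≤n) ⟨
    Lβ n j * b (suc n)     ≈⟨ *-comm _ _ ⟩
    b (suc n) * Lβ n j     ∎

  Lβ-⊗-zero : ∀ X k → (Lβ ⊗ X) 0 k ≈ X 0 k
  Lβ-⊗-zero X k = trans (+-identityˡ _) (*-identityˡ _)

  Lβ-⊗-suc : ∀ X n k → (Lβ ⊗ X) (suc n) k ≈ b (suc n) * (Lβ ⊗ X) n k + X (suc n) k
  Lβ-⊗-suc X n k = begin
    sumBelow (suc n) (λ j → Lβ (suc n) j * X j k) + Lβ (suc n) (suc n) * X (suc n) k
      ≈⟨ +-cong (Σ-cong (suc n) (λ j<1+n → trans (*-congʳ (Lβ-suc (≤-pred j<1+n))) (*-assoc _ _ _)))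
                (trans (*-congʳ (Lβ-diag (suc n))) (*-identityˡ _)) ⟩
    sumBelow (suc n) (λ j → b (suc n) * (Lβ n j * X j k)) + X (suc n) k
      ≈⟨ +-congʳ (Σ-*ˡ (suc n) (λ j → Lβ n j * X j k) (b (suc n))) ⟨
    b (suc n) * (Lβ ⊗ X) n k + X (suc n) k ∎

  Lβ-⊗-≋-solution : ∀ X {T} → (∀ k → T 0 k ≈ X 0 k) →
           (∀ n k → T (suc n) k ≈ b (suc n) * T n k + X (suc n) k) → Lβ ⊗ X ≋ T
  Lβ-⊗-≋-solution X     row₀ step zero    k = trans (Lβ-⊗-zero X k) (sym (row₀ k))
  Lβ-⊗-≋-solution X {T} row₀ step (suc n) k = begin
    (Lβ ⊗ X) (suc n) k                     ≈⟨ Lβ-⊗-suc X n k ⟩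
    b (suc n) * (Lβ ⊗ X) n k + X (suc n) k ≈⟨ +-congʳ (*-congˡ (Lβ-⊗-≋-solution X row₀ step n k)) ⟩
    b (suc n) * T n k + X (suc n) k        ≈⟨ step n k ⟨
    T (suc n) k                            ∎

  t-row₀ : ∀ k → t 0 k ≈ I 0 k
  t-row₀ zero    = refl
  t-row₀ (suc k) = refl

  t-lower : LowerTriangular t
  t-lower {zero}        {suc k}       _           = refl
  t-lower {suc zero}    {suc zero}    (s≤s ())
  t-lower {suc zero}    {suc (suc k)} _           = refl
  t-lower {suc (suc n)} {suc k}       (s≤s n<k) with suc k ≤? suc (suc n)
  ... | yes k≤n = contradiction k≤n (<⇒≱ (s≤s n<k))
  ... | no  _   = refl

  t-recurrence₁ : ∀ k → t 1 (suc k) ≈ a 1 * t 0 k + b 1 * t 0 (suc k)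
  t-recurrence₁ zero    = refl
  t-recurrence₁ (suc k) = sym (trans (+-cong (zeroʳ _) (zeroʳ _)) (+-identityʳ 0#))

  t-recurrence : ∀ n k → t (suc (suc n)) (suc k) ≈
    a (suc (suc n)) * t (suc n) k + b (suc (suc n)) * t (suc n) (suc k) + γ (suc (suc n)) * t n k
  t-recurrence n k with suc k ≤? suc (suc n)
  ... | yes _   = refl
  ... | no  k≰n = sym (begin
    a (suc (suc n)) * t (suc n) k + b (suc (suc n)) * t (suc n) (suc k) + γ (suc (suc n)) * t n k
      ≈⟨ +-cong (+-cong (*-≈0ʳ _ (t-lower 1+n<k)) (*-≈0ʳ _ (t-lower (m<n⇒m<1+n 1+n<k))))
                (*-≈0ʳ _ (t-lower (<⇒≤ 1+n<k))) ⟩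
    0# + 0# + 0# ≈⟨ trans (+-identityʳ _) (+-identityʳ 0#) ⟩
    0#           ∎)
    where
    1+n<k : suc n < k
    1+n<k = ≤-pred (≰⇒> k≰n)

  t-suc : ∀ n k → t (suc n) k ≈ b (suc n) * t n k + blk 1 (Dαγ ⊗ t) (suc n) k
  t-suc n       zero    = sym (+-identityʳ _)
  t-suc zero    (suc k) = begin
    t 1 (suc k)                           ≈⟨ t-recurrence₁ k ⟩
    a 1 * t 0 k + b 1 * t 0 (suc k)       ≈⟨ +-comm _ _ ⟩
    b 1 * t 0 (suc k) + a 1 * t 0 k       ≈⟨ +-congˡ (D-⊗-zero t k) ⟨
    b 1 * t 0 (suc k) + (Dαγ ⊗ t) 0 k     ∎
  t-suc (suc n) (suc k) = begin
    t (suc (suc n)) (suc k)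
      ≈⟨ t-recurrence n k ⟩
    a (suc (suc n)) * t (suc n) k + b (suc (suc n)) * t (suc n) (suc k) + γ (suc (suc n)) * t n k
      ≈⟨ xy∙z≈y∙zx _ _ _ ⟩
    b (suc (suc n)) * t (suc n) (suc k) + (γ (suc (suc n)) * t n k + a (suc (suc n)) * t (suc n) k)
      ≈⟨ +-congˡ (D-⊗-suc t n k) ⟨
    b (suc (suc n)) * t (suc n) (suc k) + (Dαγ ⊗ t) (suc n) k
      ∎

  ≋-sym : ∀ {A B} → A ≋ B → B ≋ A
  ≋-sym A≋B n k = sym (A≋B n k)

  Q-production : Q ⊗ blk 1 t ≋ t
  Q-production n k = begin
    (Q ⊗ blk 1 t) n k
      ≈⟨ ⊗-assoc Lβ (blk 1 Dαγ) (blk 1 t) (blk-lower 1 D-lower) n k ⟩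
    (Lβ ⊗ (blk 1 Dαγ ⊗ blk 1 t)) n k
      ≈⟨ ⊗-congˡ Lβ (≋-sym (blk₁-⊗ Dαγ t)) n k ⟩
    (Lβ ⊗ blk 1 (Dαγ ⊗ t)) n k
      ≈⟨ Lβ-⊗-≋-solution (blk 1 (Dαγ ⊗ t)) t-row₀ t-suc n k ⟩
    t n k
      ∎

  Q-lower : LowerTriangular Q
  Q-lower = ⊗-lower Lβ (blk-lower 1 D-lower)

  partialProd-lower : ∀ m → LowerTriangular (partialProd m)
  partialProd-lower zero    = Q-lower
  partialProd-lower (suc m) = ⊗-lower (partialProd m) (blk-lower (suc m) Q-lower)

  partialProd-suc : ∀ m → partialProd (suc m) ≋ Q ⊗ blk 1 (partialProd m)
  partialProd-suc zero    n k = refl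
  partialProd-suc (suc m) n k = begin
    (partialProd (suc m) ⊗ blk (suc (suc m)) Q) n k
      ≈⟨ ⊗-congʳ (blk (suc (suc m)) Q) (partialProd-suc m) n k ⟩
    ((Q ⊗ blk 1 (partialProd m)) ⊗ blk (suc (suc m)) Q) n k
      ≈⟨ ⊗-assoc Q (blk 1 (partialProd m)) (blk (suc (suc m)) Q)
                 (blk-lower 1 (partialProd-lower m)) n k ⟩
    (Q ⊗ (blk 1 (partialProd m) ⊗ blk (suc (suc m)) Q)) n k
      ≈⟨ ⊗-congˡ Q (⊗-congˡ (blk 1 (partialProd m)) (blk-suc (suc m) Q)) n k ⟩
    (Q ⊗ (blk 1 (partialProd m) ⊗ blk 1 (blk (suc m) Q))) n k
      ≈⟨ ⊗-congˡ Q (blk₁-⊗ (partialProd m) (blk (suc m) Q)) n k ⟨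
    (Q ⊗ blk 1 (partialProd (suc m))) n k
      ∎

  partialProd≈t : ∀ m → AgreeUpToRow m (partialProd m) t
  partialProd≈t zero    k z≤n = trans (Lβ-⊗-zero (blk 1 Dαγ) k) (sym (t-row₀ k))
  partialProd≈t (suc m) {j} k j≤1+m = begin
    partialProd (suc m) j k         ≈⟨ partialProd-suc m j k ⟩
    (Q ⊗ blk 1 (partialProd m)) j k ≈⟨ ⊗-agreeUpToRow Q (blk₁-agreeUpToRow (partialProd≈t m)) k j≤1+m ⟩
    (Q ⊗ blk 1 t) j k               ≈⟨ Q-production j k ⟩
    t j k                           ∎

proposition5p2 : ∀ {c ℓ : Level} (R : CommutativeRing c ℓ)
    (a b γ : ℕ → CommutativeRing.Carrier R) →
    ∀ n k → ∃ λ M → ∀ m → M ≤ m →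
      CommutativeRing._≈_ R (Setup.partialProd R a b γ m n k) (Setup.t R a b γ n k)
proposition5p2 R a b γ n k = n , λ m n≤m → Production.partialProd≈t R a b γ m k n≤m
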